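{- Let $C$ be a sufficiently large absolute constant and let $G_0$ be a graph on at most $n$ nodes in which every node $v$ has a color palette $\Psi_{G_0}(v)$ with $p_{G_0}(v):=|\Psi_{G_0}(v)| \ge d_{G_0}(v)+1$ and $p_{G_0}(v)\ge C$. Suppose the nomination choices (each node self-nominates with probability $1/4$) are determined by a hash function drawn uniformly at random from a $101$-wise independent family of hash functions $[n^{O(1)}]\to[n^{O(1)}]$. Then every node $v$ of $G_0$ fails in the nomination step with probability at most $1/p_{G_0}(v)$.
   Context: For a node $v$: $N^*(v)$ is the set of neighbors $u$ of $v$ in $G_0$ with $d_{G_0}(u)\ge 3d_{G_0}(v)$; $\mathrm{Nom}_v$ is the set of neighbors of $v$ that self-nominate; $\mathrm{Nom}^*_v=\mathrm{Nom}_v\cap N^*(v)$. Node $v$ is successful in the nomination step if both $|\mathrm{Nom}_v|\le \frac14 d_{G_0}(v)+p_{G_0}(v)^{0.7}$ and $|\mathrm{Nom}^*_v|\ge \frac14|N^*(v)|-p_{G_0}(v)^{0.7}$ hold; otherwise it fails. A family $\mathcal H$ of hash functions is $k$-wise independent if the values $\{h(x)\}$ are $k$-wise independent random variables when $h$ is uniform in $\mathcal H$; each function in such a family can be specified by an $O(\log n)$-bit seed. -}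

module Defs where

open import Data.Bool using (Bool; true; false; if_then_else_; _∧_; not)
open import Data.Nat using (ℕ; _+_; _*_; _∸_; _^_; _≤_; _≤ᵇ_; _/_)
open import Data.Fin using (Fin; toℕ)
import Data.Fin as Fin
open import Data.List using (List; length; filter; foldr; map; allFin)
open import Data.Nat.ListAction using (sum)
open import Relation.Nullary using (does)
open import Relation.Nullary.Decidable using (T?)
open import Relation.Binary.PropositionalEquality using (_≡_)
open import Function.Definitions using (Injective)

countFin : {N : ℕ} → (Fin N → Bool) → ℕ
countFin {N} P = sum (map (λ i → if P i then 1 else 0) (allFin N))

countList : {A : Set} → (A → Bool) → List A → ℕ
countList P xs = length (filter (λ x → T? (P x)) xs)

allFinB : {j : ℕ} → (Fin j → Bool) → Bool
allFinB {j} P = foldr (λ i b → P i ∧ b) true (allFin j)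

record Graph (N : ℕ) : Set where
  field
    adj       : Fin N → Fin N → Bool
    symmetric : ∀ u v → adj u v ≡ adj v u
    irrefl    : ∀ v → adj v v ≡ false
open Graph public

deg : {N : ℕ} → Graph N → Fin N → ℕ
deg G v = countFin (adj G v)

-- x ≤ 4 · p^{0.7}  (over the reals), for x, p natural;
-- equivalent to x^10 ≤ 4^10 · p^7 since both sides are nonnegative.
le4p07 : ℕ → ℕ → Bool
le4p07 x p = (x ^ 10) ≤ᵇ (4 ^ 10 * p ^ 7)

-- hash functions Fin N → Fin R (node identifiers → range [R]); node u
-- self-nominates under h iff h u < R/4  (probability exactly 1/4 when 4 ∣ R)
nominates : {N R : ℕ} → (Fin N → Fin R) → Fin N → Bool
nominates {R = R} h u = not ((R / 4) ≤ᵇ toℕ (h u))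

inNStar : {N : ℕ} → Graph N → Fin N → Fin N → Bool
inNStar G v u = adj G v u ∧ ((3 * deg G v) ≤ᵇ deg G u)

nomCount : {N R : ℕ} → Graph N → (Fin N → Fin R) → Fin N → ℕ
nomCount G h v = countFin (λ u → adj G v u ∧ nominates h u)

nomStarCount : {N R : ℕ} → Graph N → (Fin N → Fin R) → Fin N → ℕ
nomStarCount G h v = countFin (λ u → inNStar G v u ∧ nominates h u)

nStarCount : {N : ℕ} → Graph N → Fin N → ℕ
nStarCount G v = countFin (inNStar G v)

-- v is successful iff
--   |Nom_v| ≤ d(v)/4 + p(v)^0.7      ⇔ (4|Nom_v| ∸ d(v)) ≤ 4 p(v)^0.7
--   |Nom*_v| ≥ |N*(v)|/4 − p(v)^0.7   ⇔ (|N*(v)| ∸ 4|Nom*_v|) ≤ 4 p(v)^0.7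
successful : {N R : ℕ} → Graph N → (Fin N → ℕ) → (Fin N → Fin R) → Fin N → Bool
successful G p h v =
  le4p07 (4 * nomCount G h v ∸ deg G v) (p v)
  ∧ le4p07 (nStarCount G v ∸ 4 * nomStarCount G h v) (p v)

fails : {N R : ℕ} → Graph N → (Fin N → ℕ) → (Fin N → Fin R) → Fin N → Bool
fails G p h v = not (successful G p h v)

-- k-wise independent family (as a multiset H, h uniform in H): for every j ≤ k,
-- distinct keys x₁..x_j and values y₁..y_j, Pr[h(x_i) = y_i ∀ i] = 1/R^j.
KWiseIndependent : (k : ℕ) {N R : ℕ} → List (Fin N → Fin R) → Set
KWiseIndependent k {N} {R} H =
  ∀ (j : ℕ) → j ≤ k → (xs : Fin j → Fin N) → Injective _≡_ _≡_ xs →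
  (ys : Fin j → Fin R) →
  countList (λ h → allFinB (λ i → does (h (xs i) Fin.≟ ys i))) H * R ^ j ≡ length H

-- Let Zᵤ = 4·[u self-nominates] − 1 ∈ {3, −1}. When 4 ∣ R a uniform hash value makes Zᵤ
-- mean zero, with 4·E[Zᶜ] = 3ᶜ + 3(−1)ᶜ. The two failure conditions say that
-- |Σ_{u ∈ N(v)} Zᵤ| = |4|Nom_v| − d(v)| or |Σ_{u ∈ N*(v)} Zᵤ| = ||N*(v)| − 4|Nom*_v||
-- exceeds 4·p^0.7. The tenth moment of such a sum of s terms involves at most ten hash
-- values per monomial, so 101-wise independence makes it equal to the fully independent
-- value 4⁻ˢ·M 10 s, and M 10 s ≤ 32¹⁰·4ˢ·(s + 1)⁵ because a monomial survives only if
-- each of its variables occurs at least twice. Since s ≤ d(v) < p, Markov's inequality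
-- at 4¹⁰p⁷ bounds each failure probability by 32¹⁰(s + 1)⁵/(4¹⁰p⁷) ≤ 1/(2p) once
-- p ≥ C₀, and a union bound over the two conditions gives 1/p.

module Submission where

open import Defs

module Sums where

  open import Data.Bool using (Bool; true; false; _∧_)
  open import Data.Nat as ℕ using (ℕ; zero; suc)
  open import Data.Integer as ℤ using (ℤ; 0ℤ; 1ℤ; _+_; _*_)
  import Data.Integer.Properties as ℤP
  open import Data.Fin as Fin using (Fin; zero; suc)
  open import Data.Vec.Functional using () renaming (_∷_ to _∷ᵛ_)
  open import Data.List using (List; []; _∷_; length; tabulate; foldr)
  open import Relation.Binary.PropositionalEquality
  open import Relation.Nullary using (does)
  open import Function using (_∘_)
  open import Algebra.Properties.Semiring.Sum ℤP.+-*-semiring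
    using (sum; sum-cong-≗; sum-replicate-zero; ∑-distrib-+; *-distribˡ-sum; *-distribʳ-sum)
  open import Algebra.Properties.CommutativeMonoid.Sum ℤP.*-1-commutativeMonoid
    using () renaming (sum to ∏; sum-cong-≗ to ∏-cong-≗; ∑-distrib-+ to ∏-distrib-*)

  𝟙 : Bool → ℤ
  𝟙 true  = 1ℤ
  𝟙 false = 0ℤ

  𝟙-∧ : ∀ a b → 𝟙 (a ∧ b) ≡ 𝟙 a * 𝟙 b
  𝟙-∧ true  b = sym (ℤP.*-identityˡ (𝟙 b))
  𝟙-∧ false b = refl

  ∑ᴸ : {A : Set} → List A → (A → ℤ) → ℤ
  ∑ᴸ []       f = 0ℤ
  ∑ᴸ (x ∷ xs) f = f x + ∑ᴸ xs f

  module _ {A : Set} where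

    ∑ᴸ-cong : (xs : List A) {f g : A → ℤ} → (∀ x → f x ≡ g x) → ∑ᴸ xs f ≡ ∑ᴸ xs g
    ∑ᴸ-cong []       f≗g = refl
    ∑ᴸ-cong (x ∷ xs) f≗g = cong₂ _+_ (f≗g x) (∑ᴸ-cong xs f≗g)

    ∑ᴸ-zero : (xs : List A) → ∑ᴸ xs (λ _ → 0ℤ) ≡ 0ℤ
    ∑ᴸ-zero []       = refl
    ∑ᴸ-zero (x ∷ xs) = trans (ℤP.+-identityˡ _) (∑ᴸ-zero xs)

    *-distribˡ-∑ᴸ : (c : ℤ) (xs : List A) (f : A → ℤ) → c * ∑ᴸ xs f ≡ ∑ᴸ xs (λ x → c * f x)
    *-distribˡ-∑ᴸ c []       f = ℤP.*-zeroʳ c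
    *-distribˡ-∑ᴸ c (x ∷ xs) f = trans (ℤP.*-distribˡ-+ c (f x) _) (cong (c * f x +_) (*-distribˡ-∑ᴸ c xs f))

    *-distribʳ-∑ᴸ : (c : ℤ) (xs : List A) (f : A → ℤ) → ∑ᴸ xs f * c ≡ ∑ᴸ xs (λ x → f x * c)
    *-distribʳ-∑ᴸ c xs f = trans (ℤP.*-comm _ c)
      (trans (*-distribˡ-∑ᴸ c xs f) (∑ᴸ-cong xs (λ x → ℤP.*-comm c (f x))))

    ∑ᴸ-comm-sum : (xs : List A) {n : ℕ} (f : A → Fin n → ℤ) →
      ∑ᴸ xs (λ x → sum (f x)) ≡ sum (λ i → ∑ᴸ xs (λ x → f x i))
    ∑ᴸ-comm-sum []       {n} f = sym (sum-replicate-zero n)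
    ∑ᴸ-comm-sum (x ∷ xs) f =
      trans (cong (sum (f x) +_) (∑ᴸ-comm-sum xs f)) (sym (∑-distrib-+ (f x) _))

    +count≡∑ᴸ𝟙 : (P : A → Bool) (xs : List A) → ℤ.+ countList P xs ≡ ∑ᴸ xs (𝟙 ∘ P)
    +count≡∑ᴸ𝟙 P []       = refl
    +count≡∑ᴸ𝟙 P (x ∷ xs) with P x
    ... | true  = cong (1ℤ +_) (+count≡∑ᴸ𝟙 P xs)
    ... | false = trans (+count≡∑ᴸ𝟙 P xs) (sym (ℤP.+-identityˡ _))

  ∑ᶠ : (j R : ℕ) → ((Fin j → Fin R) → ℤ) → ℤ
  ∑ᶠ zero    R F = F (λ ())
  ∑ᶠ (suc j) R F = sum (λ y → ∑ᶠ j R (λ ys → F (y ∷ᵛ ys)))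

  module _ {R : ℕ} where

    ∑ᶠ-cong : ∀ j {F G : (Fin j → Fin R) → ℤ} → (∀ ys → F ys ≡ G ys) → ∑ᶠ j R F ≡ ∑ᶠ j R G
    ∑ᶠ-cong zero    F≗G = F≗G _
    ∑ᶠ-cong (suc j) F≗G = sum-cong-≗ (λ y → ∑ᶠ-cong j (λ ys → F≗G (y ∷ᵛ ys)))

    *-distribˡ-∑ᶠ : ∀ j c (F : (Fin j → Fin R) → ℤ) → c * ∑ᶠ j R F ≡ ∑ᶠ j R (λ ys → c * F ys)
    *-distribˡ-∑ᶠ zero    c F = refl
    *-distribˡ-∑ᶠ (suc j) c F = trans (*-distribˡ-sum {R} c _)
      (sum-cong-≗ (λ y → *-distribˡ-∑ᶠ j c (λ ys → F (y ∷ᵛ ys))))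

    ∑ᴸ-comm-∑ᶠ : {A : Set} (xs : List A) (j : ℕ) (F : A → (Fin j → Fin R) → ℤ) →
      ∑ᴸ xs (λ x → ∑ᶠ j R (F x)) ≡ ∑ᶠ j R (λ ys → ∑ᴸ xs (λ x → F x ys))
    ∑ᴸ-comm-∑ᶠ xs zero    F = refl
    ∑ᴸ-comm-∑ᶠ xs (suc j) F = trans (∑ᴸ-comm-sum xs {R} _)
      (sum-cong-≗ (λ y → ∑ᴸ-comm-∑ᶠ xs j (λ x ys → F x (y ∷ᵛ ys))))

    ∑ᶠ-∏ : ∀ j (f : Fin j → Fin R → ℤ) → ∑ᶠ j R (λ ys → ∏ (λ i → f i (ys i))) ≡ ∏ (λ i → sum (f i))
    ∑ᶠ-∏ zero    f = refl
    ∑ᶠ-∏ (suc j) f = begin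
        sum (λ y → ∑ᶠ j R (λ ys → f zero y * ∏ (λ i → f (suc i) (ys i))))
      ≡⟨ sum-cong-≗ (λ y → *-distribˡ-∑ᶠ j (f zero y) _) ⟨
        sum (λ y → f zero y * ∑ᶠ j R (λ ys → ∏ (λ i → f (suc i) (ys i))))
      ≡⟨ *-distribʳ-sum _ (f zero) ⟨
        sum (f zero) * ∑ᶠ j R (λ ys → ∏ (λ i → f (suc i) (ys i)))
      ≡⟨ cong (sum (f zero) *_) (∑ᶠ-∏ j (f ∘ suc)) ⟩
        ∏ (λ i → sum (f i)) ∎
      where open ≡-Reasoning

  sum-δ : ∀ {n} (x : Fin n) (c : Fin n → ℤ) → sum (λ y → 𝟙 (does (x Fin.≟ y)) * c y) ≡ c x
  sum-δ {suc n} zero    c = begin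
      1ℤ * c zero + sum (λ y → 0ℤ * c (suc y))  ≡⟨ cong₂ _+_ (ℤP.*-identityˡ (c zero)) (sum-replicate-zero n) ⟩
      c zero + 0ℤ                              ≡⟨ ℤP.+-identityʳ (c zero) ⟩
      c zero                                   ∎
    where open ≡-Reasoning
  sum-δ {suc n} (suc x) c = trans (ℤP.+-identityˡ _) (sum-δ x (c ∘ suc))

  𝟙-foldr-∧ : ∀ {m} n (P : Fin m → Bool) (g : Fin n → Fin m) →
    𝟙 (foldr (λ i b → P i ∧ b) true (tabulate g)) ≡ ∏ (λ i → 𝟙 (P (g i)))
  𝟙-foldr-∧ zero    P g = refl
  𝟙-foldr-∧ (suc n) P g = trans (𝟙-∧ (P (g zero)) _) (cong (𝟙 (P (g zero)) *_) (𝟙-foldr-∧ n P (g ∘ suc)))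

  𝟙-allFinB : ∀ {n} (P : Fin n → Bool) → 𝟙 (allFinB P) ≡ ∏ (𝟙 ∘ P)
  𝟙-allFinB {n} P = 𝟙-foldr-∧ n P (λ i → i)

  module _ {R : ℕ} where

    _≐_ : ∀ {j} → (Fin j → Fin R) → (Fin j → Fin R) → Bool
    g ≐ ys = allFinB (λ i → does (g i Fin.≟ ys i))

    ∑ᶠ-select : ∀ j (g : Fin j → Fin R) (f : Fin j → Fin R → ℤ) →
      ∑ᶠ j R (λ ys → 𝟙 (g ≐ ys) * ∏ (λ i → f i (ys i))) ≡ ∏ (λ i → f i (g i))
    ∑ᶠ-select j g f = begin
        ∑ᶠ j R (λ ys → 𝟙 (g ≐ ys) * ∏ (λ i → f i (ys i)))
      ≡⟨ ∑ᶠ-cong j (λ ys → trans (cong (_* _) (𝟙-allFinB (λ i → does (g i Fin.≟ ys i))))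
                                 (sym (∏-distrib-* (λ i → 𝟙 (does (g i Fin.≟ ys i))) (λ i → f i (ys i))))) ⟩
        ∑ᶠ j R (λ ys → ∏ (λ i → 𝟙 (does (g i Fin.≟ ys i)) * f i (ys i)))
      ≡⟨ ∑ᶠ-∏ j (λ i y → 𝟙 (does (g i Fin.≟ y)) * f i y) ⟩
        ∏ (λ i → sum (λ y → 𝟙 (does (g i Fin.≟ y)) * f i y))
      ≡⟨ ∏-cong-≗ (λ i → sum-δ (g i) (f i)) ⟩
        ∏ (λ i → f i (g i)) ∎
      where open ≡-Reasoning

  module _ {N R : ℕ} (H : List (Fin N → Fin R)) (j : ℕ) (xs : Fin j → Fin N)
           (uniform : ∀ ys → countList (λ h → (h ∘ xs) ≐ ys) H ℕ.* R ℕ.^ j ≡ length H) where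

    ∑ᴸ-∏-uniform : (f : Fin j → Fin R → ℤ) →
      ∑ᴸ H (λ h → ∏ (λ i → f i (h (xs i)))) * ℤ.+ (R ℕ.^ j) ≡ ℤ.+ length H * ∏ (λ i → sum (f i))
    ∑ᴸ-∏-uniform f = begin
        ∑ᴸ H (λ h → ∏ (λ i → f i (h (xs i)))) * Rʲ
      ≡⟨ cong (_* Rʲ) (∑ᴸ-cong H (λ h → ∑ᶠ-select j (h ∘ xs) f)) ⟨
        ∑ᴸ H (λ h → ∑ᶠ j R (λ ys → 𝟙 ((h ∘ xs) ≐ ys) * Πf ys)) * Rʲ
      ≡⟨ cong (_* Rʲ) (∑ᴸ-comm-∑ᶠ H j _) ⟩
        ∑ᶠ j R (λ ys → ∑ᴸ H (λ h → 𝟙 ((h ∘ xs) ≐ ys) * Πf ys)) * Rʲ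
      ≡⟨ trans (ℤP.*-comm _ Rʲ) (*-distribˡ-∑ᶠ j Rʲ _) ⟩
        ∑ᶠ j R (λ ys → Rʲ * ∑ᴸ H (λ h → 𝟙 ((h ∘ xs) ≐ ys) * Πf ys))
      ≡⟨ ∑ᶠ-cong j (λ ys → average ys (Πf ys)) ⟩
        ∑ᶠ j R (λ ys → ℤ.+ length H * Πf ys)
      ≡⟨ *-distribˡ-∑ᶠ j (ℤ.+ length H) Πf ⟨
        ℤ.+ length H * ∑ᶠ j R Πf
      ≡⟨ cong (ℤ.+ length H *_) (∑ᶠ-∏ j f) ⟩
        ℤ.+ length H * ∏ (λ i → sum (f i)) ∎
      where
      open ≡-Reasoning
      Rʲ = ℤ.+ (R ℕ.^ j)
      Πf : (Fin j → Fin R) → ℤ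
      Πf ys = ∏ (λ i → f i (ys i))
      average : ∀ ys c → Rʲ * ∑ᴸ H (λ h → 𝟙 ((h ∘ xs) ≐ ys) * c) ≡ ℤ.+ length H * c
      average ys c = begin
          Rʲ * ∑ᴸ H (λ h → 𝟙 ((h ∘ xs) ≐ ys) * c)
        ≡⟨ cong (Rʲ *_) (*-distribʳ-∑ᴸ c H _) ⟨
          Rʲ * (∑ᴸ H (λ h → 𝟙 ((h ∘ xs) ≐ ys)) * c)
        ≡⟨ cong (λ t → Rʲ * (t * c)) (+count≡∑ᴸ𝟙 (λ h → (h ∘ xs) ≐ ys) H) ⟨
          Rʲ * (ℤ.+ count * c)
        ≡⟨ ℤP.*-assoc Rʲ _ c ⟨
          Rʲ * ℤ.+ count * c
        ≡⟨ cong (_* c) (trans (ℤP.*-comm Rʲ _) (sym (ℤP.pos-* count (R ℕ.^ j)))) ⟩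
          ℤ.+ (count ℕ.* R ℕ.^ j) * c
        ≡⟨ cong (λ t → ℤ.+ t * c) (uniform ys) ⟩
          ℤ.+ length H * c ∎
        where count = countList (λ h → (h ∘ xs) ≐ ys) H

module Nomination where

  open import Data.Bool using (Bool; true; false; not; if_then_else_)
  open import Data.Nat as ℕ using (ℕ; zero; suc; _≤ᵇ_; _∸_; _/_)
  import Data.Nat.Properties as ℕP
  open import Data.Nat.DivMod using (m*n/n≡m)
  open import Data.Integer as ℤ using (ℤ; 1ℤ; -1ℤ; _+_; _*_; _^_)
  import Data.Integer.Properties as ℤP
  open import Data.Fin as Fin using (Fin; toℕ)
  open import Relation.Binary.PropositionalEquality
  open import Algebra.Properties.Semiring.Sum ℤP.+-*-semiring using (sum; sum-cong-≗; sum-replicate)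
  open import Algebra.Properties.Semiring.Mult ℤP.+-*-semiring using (_×_)
  open import Data.Integer.Tactic.RingSolver using (solve-∀)

  ×≡* : ∀ n x → n × x ≡ ℤ.+ n * x
  ×≡* zero    x = sym (ℤP.*-zeroˡ x)
  ×≡* (suc n) x = begin
      x + n × x            ≡⟨ cong (x +_) (×≡* n x) ⟩
      x + ℤ.+ n * x        ≡⟨ cong (_+ ℤ.+ n * x) (ℤP.*-identityˡ x) ⟨
      1ℤ * x + ℤ.+ n * x   ≡⟨ ℤP.*-distribʳ-+ x 1ℤ (ℤ.+ n) ⟨
      ℤ.+ (suc n) * x      ∎
    where open ≡-Reasoning

  +^≡+^ : ∀ a c → (ℤ.+ a) ^ c ≡ ℤ.+ (a ℕ.^ c)
  +^≡+^ a zero    = refl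
  +^≡+^ a (suc c) = trans (cong (ℤ.+ a *_) (+^≡+^ a c)) (sym (ℤP.pos-* a (a ℕ.^ c)))

  ζ : Bool → ℤ
  ζ true  = ℤ.+ 3
  ζ false = -1ℤ

  lowQuarter : ∀ {R} → Fin R → Bool
  lowQuarter {R} y = not ((R / 4) ≤ᵇ toℕ y)

  Z : ∀ {R} → Fin R → ℤ
  Z y = ζ (lowQuarter y)

  even : ℕ → Bool
  even zero          = true
  even (suc zero)    = false
  even (suc (suc n)) = even n

  -- 4·E[Zᶜ] = 3ᶜ + 3·(−1)ᶜ
  ν : ℕ → ℕ
  ν c = if even c then 3 ℕ.^ c ℕ.+ 3 else 3 ℕ.^ c ∸ 3

  -1^ : ∀ c → -1ℤ ^ c ≡ (if even c then 1ℤ else -1ℤ)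
  -1^ zero          = refl
  -1^ (suc zero)    = refl
  -1^ (suc (suc c)) = trans (sym (ℤP.*-assoc -1ℤ -1ℤ (-1ℤ ^ c))) (trans (ℤP.*-identityˡ (-1ℤ ^ c)) (-1^ c))

  ζ-moment : ∀ c → ζ true ^ c + ℤ.+ 3 * ζ false ^ c ≡ ℤ.+ ν c
  ζ-moment c rewrite -1^ c | +^≡+^ 3 c = by-parity c (even c) refl
    where
    by-parity : ∀ c b → even c ≡ b →
      ℤ.+ (3 ℕ.^ c) + ℤ.+ 3 * (if b then 1ℤ else -1ℤ) ≡ ℤ.+ (if b then 3 ℕ.^ c ℕ.+ 3 else 3 ℕ.^ c ∸ 3)
    by-parity c       true  _  = sym (ℤP.pos-+ (3 ℕ.^ c) 3)
    by-parity zero    false ()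
    by-parity (suc c) false _  =
      trans (ℤP.m-n≡m⊖n (3 ℕ.^ suc c) 3) (ℤP.⊖-≥ (ℕP.*-monoʳ-≤ 3 (ℕP.m^n>0 3 c)))

  sum-threshold : ∀ n q → q ℕ.≤ n → (G : Bool → ℤ) →
    sum {n} (λ i → G (not (q ≤ᵇ toℕ i))) ≡ ℤ.+ q * G true + ℤ.+ (n ∸ q) * G false
  sum-threshold n       zero    _            G =
    trans (trans (sum-replicate n) (×≡* n (G false))) (sym (ℤP.+-identityˡ _))
  sum-threshold (suc n) (suc q) (ℕ.s≤s q≤n) G =
    trans (cong (G true +_) (trans (sum-cong-≗ {n} (λ i → cong (λ b → G (not b)) (≤ᵇ-suc q (toℕ i))))
                                   (sum-threshold n q q≤n G)))
          (regroup (G true) (G false) q (n ∸ q))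
    where
    ≤ᵇ-suc : ∀ q t → (suc q ≤ᵇ suc t) ≡ (q ≤ᵇ t)
    ≤ᵇ-suc zero    t = refl
    ≤ᵇ-suc (suc q) t = refl
    regroup : ∀ a b q m → a + (ℤ.+ q * a + ℤ.+ m * b) ≡ ℤ.+ (suc q) * a + ℤ.+ m * b
    regroup a b q m rewrite ℤP.pos-+ 1 q = ring a b (ℤ.+ q) (ℤ.+ m)
      where
      ring : ∀ a b x y → a + (x * a + y * b) ≡ (ℤ.+ 1 + x) * a + y * b
      ring = solve-∀

  sum-Z^ : ∀ k c → sum {k ℕ.* 4} (λ y → Z y ^ c) ≡ ℤ.+ k * ℤ.+ ν c
  sum-Z^ k c = begin
      sum {k ℕ.* 4} (λ y → ζ (not ((k ℕ.* 4 / 4) ≤ᵇ toℕ y)) ^ c)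
    ≡⟨ cong (λ q → sum {k ℕ.* 4} (λ y → ζ (not (q ≤ᵇ toℕ y)) ^ c)) (m*n/n≡m k 4) ⟩
      sum {k ℕ.* 4} (λ y → ζ (not (k ≤ᵇ toℕ y)) ^ c)
    ≡⟨ sum-threshold (k ℕ.* 4) k (ℕP.m≤m*n k 4) (λ b → ζ b ^ c) ⟩
      ℤ.+ k * ζ true ^ c + ℤ.+ (k ℕ.* 4 ∸ k) * ζ false ^ c
    ≡⟨ cong (λ t → ℤ.+ k * ζ true ^ c + ℤ.+ t * ζ false ^ c) 4k∸k≡3k ⟩
      ℤ.+ k * ζ true ^ c + ℤ.+ (k ℕ.* 3) * ζ false ^ c
    ≡⟨ cong (λ t → ℤ.+ k * ζ true ^ c + t * ζ false ^ c) (ℤP.pos-* k 3) ⟩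
      ℤ.+ k * ζ true ^ c + ℤ.+ k * ℤ.+ 3 * ζ false ^ c
    ≡⟨ factor (ℤ.+ k) (ζ true ^ c) (ζ false ^ c) ⟩
      ℤ.+ k * (ζ true ^ c + ℤ.+ 3 * ζ false ^ c)
    ≡⟨ cong (ℤ.+ k *_) (ζ-moment c) ⟩
      ℤ.+ k * ℤ.+ ν c ∎
    where
    open ≡-Reasoning
    4k∸k≡3k : k ℕ.* 4 ∸ k ≡ k ℕ.* 3
    4k∸k≡3k = trans (cong (_∸ k) (ℕP.*-suc k 3)) (ℕP.m+n∸m≡n k (k ℕ.* 3))
    factor : ∀ x a b → x * a + x * ℤ.+ 3 * b ≡ x * (a + ℤ.+ 3 * b)
    factor = solve-∀

module Moments where

  open import Data.Nat as ℕ using (ℕ; zero; suc; _∸_)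
  import Data.Nat.Properties as ℕP
  open import Data.Nat.Combinatorics using (_C_)
  open import Data.Integer as ℤ using (ℤ; 1ℤ; _+_; _*_; _^_)
  import Data.Integer.Properties as ℤP
  open import Data.Fin as Fin using (Fin; zero; suc; toℕ)
  import Data.Fin.Properties as FinP
  open import Data.List using (List; []; _∷_; map; length; lookup; _++_; [_])
  import Data.List.Properties as ListP
  import Data.List.Relation.Unary.All as All
  import Data.List.Relation.Unary.All.Properties as AllP
  open import Data.List.Membership.Propositional.Properties using (∈-map⁺; ∈-lookup)
  open import Data.List.Relation.Unary.AllPairs using (_∷_)
  open import Data.List.Relation.Unary.Unique.Propositional using (Unique)
  open import Data.Product using (_×_; _,_; proj₁; proj₂)
  open import Data.Sum using (inj₁; inj₂)
  open import Data.Empty using (⊥-elim)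
  open import Relation.Binary.PropositionalEquality hiding ([_])
  open import Function using (_∘_)
  open import Algebra.Properties.Semiring.Sum ℤP.+-*-semiring
    using (sum; sum-cong-≗; *-distribˡ-sum; *-distribʳ-sum)
  open import Algebra.Properties.Semiring.Sum ℕP.+-*-semiring using () renaming (sum to sumℕ)
  open import Algebra.Properties.CommutativeMonoid.Sum ℤP.*-1-commutativeMonoid using () renaming (sum to ∏)
  open import Algebra.Properties.Semiring.Exp ℤP.+-*-semiring using () renaming (_^_ to _^ₛ_)
  import Algebra.Properties.CommutativeSemiring.Binomial ℤP.+-*-commutativeSemiring as Binomial
  open import Data.Integer.Tactic.RingSolver using (solve-∀)
  open import Data.Nat.Tactic.RingSolver using () renaming (solve-∀ to solve-∀ℕ)
  open Sums
  open Nomination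

  ^ₛ≡^ : ∀ x n → x ^ₛ n ≡ x ^ n
  ^ₛ≡^ x zero    = refl
  ^ₛ≡^ x (suc n) = cong (x *_) (^ₛ≡^ x n)

  binomial : ∀ k x y → (x + y) ^ k ≡ sum {suc k} (λ j → ℤ.+ (k C toℕ j) * (x ^ toℕ j * y ^ (k ∸ toℕ j)))
  binomial k x y = trans (sym (^ₛ≡^ (x + y) k)) (trans (Binomial.theorem k x y)
    (sum-cong-≗ {suc k} (λ j → trans (×≡* (k C toℕ j) _)
      (cong (ℤ.+ (k C toℕ j) *_) (cong₂ _*_ (^ₛ≡^ x (toℕ j)) (^ₛ≡^ y (k ∸ toℕ j)))))))

  +sumℕ : ∀ n (f : Fin n → ℕ) → ℤ.+ (sumℕ f) ≡ sum (ℤ.+_ ∘ f)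
  +sumℕ zero    f = refl
  +sumℕ (suc n) f = trans (ℤP.pos-+ (f zero) _) (cong (ℤ.+ (f zero) +_) (+sumℕ n (f ∘ suc)))

  -- 4ˢ·E[(Z₁ + ⋯ + Zₛ)ᵏ] for independent copies Zᵢ of Z, via the binomial expansion in Zₛ₊₁.
  M : ℕ → ℕ → ℕ
  M k       (suc s) = sumℕ {suc k} (λ j → (k C toℕ j) ℕ.* ν (k ∸ toℕ j) ℕ.* M (toℕ j) s)
  M zero    zero    = 1
  M (suc k) zero    = 0

  *-^ : ∀ a b n → (a ℕ.* b) ℕ.^ n ≡ a ℕ.^ n ℕ.* b ℕ.^ n
  *-^ a b zero    = refl
  *-^ a b (suc n) rewrite *-^ a b n = interchange a b (a ℕ.^ n) (b ℕ.^ n)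
    where
    interchange : ∀ a b x y → a ℕ.* b ℕ.* (x ℕ.* y) ≡ a ℕ.* x ℕ.* (b ℕ.* y)
    interchange = solve-∀ℕ

  module _ {A B : Set} where

    lookup-injective : (L : List (A × B)) → Unique (map proj₁ L) →
      ∀ {i j} → proj₁ (lookup L i) ≡ proj₁ (lookup L j) → i ≡ j
    lookup-injective (x ∷ L) (x∉L ∷ uL) {zero}  {zero}  _ = refl
    lookup-injective (x ∷ L) (x∉L ∷ uL) {zero}  {suc j} e = ⊥-elim (All.lookup x∉L (∈-map⁺ proj₁ (∈-lookup j)) e)
    lookup-injective (x ∷ L) (x∉L ∷ uL) {suc i} {zero}  e = ⊥-elim (All.lookup x∉L (∈-map⁺ proj₁ (∈-lookup i)) (sym e))
    lookup-injective (x ∷ L) (x∉L ∷ uL) {suc i} {suc j} e = cong suc (lookup-injective L uL e)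

  unique-drop : ∀ {A : Set} xs (y : A) ys → Unique (xs ++ y ∷ ys) → Unique (xs ++ ys)
  unique-drop []       y ys (_ ∷ u) = u
  unique-drop (x ∷ xs) y ys (p ∷ u) = AllP.++⁺ (AllP.++⁻ˡ xs p) (All.tail (AllP.++⁻ʳ xs p)) ∷ unique-drop xs y ys u

  module _ {N : ℕ} where

    νᴸ : List (Fin N × ℕ) → ℤ
    νᴸ []            = 1ℤ
    νᴸ ((u , c) ∷ L) = ℤ.+ ν c * νᴸ L

    νᴸ-snoc : ∀ L u c → νᴸ (L ++ [ (u , c) ]) ≡ νᴸ L * ℤ.+ ν c
    νᴸ-snoc []            u c = trans (ℤP.*-identityʳ _) (sym (ℤP.*-identityˡ _))
    νᴸ-snoc ((v , d) ∷ L) u c = trans (cong (ℤ.+ ν d *_) (νᴸ-snoc L u c)) (sym (ℤP.*-assoc (ℤ.+ ν d) (νᴸ L) _))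

    module _ {R : ℕ} where

      W : (Fin N → Fin R) → List (Fin N × ℕ) → ℤ
      W h []            = 1ℤ
      W h ((u , c) ∷ L) = Z (h u) ^ c * W h L

      Y : (Fin N → Fin R) → List (Fin N) → ℤ
      Y h S = ∑ᴸ S (λ u → Z (h u))

      W≡∏ : (h : Fin N → Fin R) (L : List (Fin N × ℕ)) →
        W h L ≡ ∏ (λ i → Z (h (proj₁ (lookup L i))) ^ proj₂ (lookup L i))
      W≡∏ h []            = refl
      W≡∏ h ((u , c) ∷ L) = cong (Z (h u) ^ c *_) (W≡∏ h L)

      W-snoc : ∀ (h : Fin N → Fin R) L u c → W h (L ++ [ (u , c) ]) ≡ W h L * Z (h u) ^ c
      W-snoc h []            u c = trans (ℤP.*-identityʳ _) (sym (ℤP.*-identityˡ _))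
      W-snoc h ((v , d) ∷ L) u c =
        trans (cong (Z (h v) ^ d *_) (W-snoc h L u c)) (sym (ℤP.*-assoc (Z (h v) ^ d) (W h L) _))

  module _ {N d r : ℕ} .{{_ : ℕ.NonZero r}} (H : List (Fin N → Fin (r ℕ.* 4))) (independent : KWiseIndependent d H) where

    private
      ∣H∣ : ℤ
      ∣H∣ = ℤ.+ length H

    ∏-sum-Z^ : (L : List (Fin N × ℕ)) →
      ∏ (λ i → sum {r ℕ.* 4} (λ y → Z y ^ proj₂ (lookup L i))) ≡ (ℤ.+ r) ^ length L * νᴸ L
    ∏-sum-Z^ []            = refl
    ∏-sum-Z^ ((u , c) ∷ L) = trans (cong₂ _*_ (sum-Z^ r c) (∏-sum-Z^ L)) (interchange (ℤ.+ r) (ℤ.+ ν c) _ (νᴸ L))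
      where
      interchange : ∀ a b c d → a * b * (c * d) ≡ a * c * (b * d)
      interchange = solve-∀

    ∑ᴸ-W : (L : List (Fin N × ℕ)) → Unique (map proj₁ L) → length L ℕ.≤ d →
      ∑ᴸ H (λ h → W h L) * ℤ.+ (4 ℕ.^ length L) ≡ ∣H∣ * νᴸ L
    ∑ᴸ-W L unique m≤d = ℤP.*-cancelˡ-≡ rᵐ _ _ {{ℕP.m^n≢0 r m}} (begin
        rᵐ * (∑W * 4ᵐ)
      ≡⟨ rearrange rᵐ ∑W 4ᵐ ⟩
        ∑W * (rᵐ * 4ᵐ)
      ≡⟨ cong (∑W *_) (trans (sym (ℤP.pos-* (r ℕ.^ m) (4 ℕ.^ m))) (cong ℤ.+_ (sym (*-^ r 4 m)))) ⟩
        ∑W * ℤ.+ ((r ℕ.* 4) ℕ.^ m)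
      ≡⟨ cong (_* ℤ.+ ((r ℕ.* 4) ℕ.^ m)) (∑ᴸ-cong H (λ h → W≡∏ h L)) ⟩
        ∑ᴸ H (λ h → ∏ (λ i → Z (h (xs i)) ^ proj₂ (lookup L i))) * ℤ.+ ((r ℕ.* 4) ℕ.^ m)
      ≡⟨ ∑ᴸ-∏-uniform H m xs uniform (λ i y → Z y ^ proj₂ (lookup L i)) ⟩
        ∣H∣ * ∏ (λ i → sum {r ℕ.* 4} (λ y → Z y ^ proj₂ (lookup L i)))
      ≡⟨ cong (∣H∣ *_) (trans (∏-sum-Z^ L) (cong (_* νᴸ L) (+^≡+^ r m))) ⟩
        ∣H∣ * (rᵐ * νᴸ L)
      ≡⟨ rearrange ∣H∣ rᵐ (νᴸ L) ⟩
        rᵐ * (∣H∣ * νᴸ L) ∎)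
      where
      open ≡-Reasoning
      m = length L
      xs : Fin m → Fin N
      xs i = proj₁ (lookup L i)
      uniform : ∀ ys → countList (λ h → (h ∘ xs) ≐ ys) H ℕ.* (r ℕ.* 4) ℕ.^ m ≡ length H
      uniform = independent m m≤d xs (lookup-injective L unique)
      ∑W = ∑ᴸ H (λ h → W h L)
      rᵐ = ℤ.+ (r ℕ.^ m)
      4ᵐ = ℤ.+ (4 ℕ.^ m)
      rearrange : ∀ a b c → a * (b * c) ≡ b * (a * c)
      rearrange = solve-∀

    MomentIdentity : List (Fin N) → Set
    MomentIdentity S = ∀ L n → Unique (map proj₁ L ++ S) → length L ℕ.+ n ℕ.≤ d →
      ∑ᴸ H (λ h → W h L * Y h S ^ n) * ℤ.+ (4 ℕ.^ (length L ℕ.+ length S)) ≡ ∣H∣ * νᴸ L * ℤ.+ (M n (length S))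

    moment-[] : MomentIdentity []
    moment-[] L zero unique L≤d = begin
        ∑ᴸ H (λ h → W h L * 1ℤ) * ℤ.+ (4 ℕ.^ (length L ℕ.+ 0))
      ≡⟨ cong₂ _*_ (∑ᴸ-cong H (λ h → ℤP.*-identityʳ (W h L))) (cong (λ t → ℤ.+ (4 ℕ.^ t)) (ℕP.+-identityʳ (length L))) ⟩
        ∑ᴸ H (λ h → W h L) * ℤ.+ (4 ℕ.^ length L)
      ≡⟨ ∑ᴸ-W L (subst Unique (ListP.++-identityʳ _) unique) (subst (ℕ._≤ d) (ℕP.+-identityʳ (length L)) L≤d) ⟩
        ∣H∣ * νᴸ L
      ≡⟨ ℤP.*-identityʳ _ ⟨
        ∣H∣ * νᴸ L * ℤ.+ 1 ∎
      where open ≡-Reasoning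
    moment-[] L (suc n) _ _ =
      trans (cong (_* ℤ.+ (4 ℕ.^ (length L ℕ.+ 0))) (trans (∑ᴸ-cong H (λ h → ℤP.*-zeroʳ (W h L))) (∑ᴸ-zero H)))
            (sym (ℤP.*-zeroʳ (∣H∣ * νᴸ L)))

    -- The binomial expansion of (Z (h u) + Y h S)ⁿ; its j-th term moves Z (h u)ⁿ⁻ʲ into the monomial L.
    module _ (u : Fin N) (S : List (Fin N)) (moment-S : MomentIdentity S) (L : List (Fin N × ℕ)) (n : ℕ)
             (unique : Unique (map proj₁ L ++ u ∷ S)) (L+n≤d : length L ℕ.+ n ℕ.≤ d) where

      private
        s : ℕ
        s = length S
        P : ℤ
        P = ℤ.+ (4 ℕ.^ (length L ℕ.+ suc s))
        T : (Fin N → Fin (r ℕ.* 4)) → ℕ → ℤ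
        T h j = W h L * Z (h u) ^ (n ∸ j) * Y h S ^ j

      expand : ∀ h → W h L * Y h (u ∷ S) ^ n ≡ sum {suc n} (λ j → ℤ.+ (n C toℕ j) * T h (toℕ j))
      expand h = begin
          W h L * (Z (h u) + Y h S) ^ n
        ≡⟨ cong (λ t → W h L * t ^ n) (ℤP.+-comm (Z (h u)) (Y h S)) ⟩
          W h L * (Y h S + Z (h u)) ^ n
        ≡⟨ cong (W h L *_) (binomial n (Y h S) (Z (h u))) ⟩
          W h L * sum {suc n} (λ j → ℤ.+ (n C toℕ j) * (Y h S ^ toℕ j * Z (h u) ^ (n ∸ toℕ j)))
        ≡⟨ *-distribˡ-sum {suc n} (W h L) (λ j → ℤ.+ (n C toℕ j) * (Y h S ^ toℕ j * Z (h u) ^ (n ∸ toℕ j))) ⟩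
          sum {suc n} (λ j → W h L * (ℤ.+ (n C toℕ j) * (Y h S ^ toℕ j * Z (h u) ^ (n ∸ toℕ j))))
        ≡⟨ sum-cong-≗ {suc n} (λ j → reorder (W h L) (ℤ.+ (n C toℕ j)) (Y h S ^ toℕ j) (Z (h u) ^ (n ∸ toℕ j))) ⟩
          sum {suc n} (λ j → ℤ.+ (n C toℕ j) * T h (toℕ j)) ∎
        where
        open ≡-Reasoning
        reorder : ∀ w c y z → w * (c * (y * z)) ≡ c * (w * z * y)
        reorder = solve-∀

      last-term : ∑ᴸ H (λ h → T h n) * P ≡ ∣H∣ * νᴸ L * ℤ.+ (ν (n ∸ n) ℕ.* M n s)
      last-term rewrite ℕP.n∸n≡0 n = begin
          ∑ᴸ H (λ h → W h L * 1ℤ * Y h S ^ n) * P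
        ≡⟨ cong₂ _*_ (∑ᴸ-cong H (λ h → cong (_* Y h S ^ n) (ℤP.*-identityʳ (W h L))))
                     (trans (cong (λ t → ℤ.+ (4 ℕ.^ t)) (ℕP.+-suc (length L) s)) (ℤP.pos-* 4 (4 ℕ.^ (length L ℕ.+ s)))) ⟩
          ∑ᴸ H (λ h → W h L * Y h S ^ n) * (ℤ.+ 4 * ℤ.+ (4 ℕ.^ (length L ℕ.+ s)))
        ≡⟨ swap₃ (∑ᴸ H (λ h → W h L * Y h S ^ n)) (ℤ.+ 4) _ ⟩
          ℤ.+ 4 * (∑ᴸ H (λ h → W h L * Y h S ^ n) * ℤ.+ (4 ℕ.^ (length L ℕ.+ s)))
        ≡⟨ cong (ℤ.+ 4 *_) (moment-S L n (unique-drop (map proj₁ L) u S unique) L+n≤d) ⟩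
          ℤ.+ 4 * (∣H∣ * νᴸ L * ℤ.+ (M n s))
        ≡⟨ swap₃ (ℤ.+ 4) (∣H∣ * νᴸ L) _ ⟩
          ∣H∣ * νᴸ L * (ℤ.+ 4 * ℤ.+ (M n s))
        ≡⟨ cong (∣H∣ * νᴸ L *_) (ℤP.pos-* 4 (M n s)) ⟨
          ∣H∣ * νᴸ L * ℤ.+ (4 ℕ.* M n s) ∎
        where
        open ≡-Reasoning
        swap₃ : ∀ a b c → a * (b * c) ≡ b * (a * c)
        swap₃ = solve-∀

      inner-term : ∀ j → j ℕ.< n → ∑ᴸ H (λ h → T h j) * P ≡ ∣H∣ * νᴸ L * ℤ.+ (ν (n ∸ j) ℕ.* M j s)
      inner-term j j<n = begin
          ∑ᴸ H (λ h → W h L * Z (h u) ^ c * Y h S ^ j) * P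
        ≡⟨ cong₂ _*_ (∑ᴸ-cong H (λ h → cong (_* Y h S ^ j) (W-snoc h L u c))) (cong (λ t → ℤ.+ (4 ℕ.^ t)) |L′|+s) ⟨
          ∑ᴸ H (λ h → W h L′ * Y h S ^ j) * ℤ.+ (4 ℕ.^ (length L′ ℕ.+ s))
        ≡⟨ moment-S L′ j unique′ L′+j≤d ⟩
          ∣H∣ * νᴸ L′ * ℤ.+ (M j s)
        ≡⟨ cong (λ t → ∣H∣ * t * ℤ.+ (M j s)) (νᴸ-snoc L u c) ⟩
          ∣H∣ * (νᴸ L * ℤ.+ ν c) * ℤ.+ (M j s)
        ≡⟨ reassoc ∣H∣ (νᴸ L) (ℤ.+ ν c) (ℤ.+ (M j s)) ⟩
          ∣H∣ * νᴸ L * (ℤ.+ ν c * ℤ.+ (M j s))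
        ≡⟨ cong (∣H∣ * νᴸ L *_) (ℤP.pos-* (ν c) (M j s)) ⟨
          ∣H∣ * νᴸ L * ℤ.+ (ν c ℕ.* M j s) ∎
        where
        open ≡-Reasoning
        c = n ∸ j
        L′ = L ++ [ (u , c) ]
        |L′| : length L′ ≡ length L ℕ.+ 1
        |L′| = ListP.length-++ L
        |L′|+s : length L′ ℕ.+ s ≡ length L ℕ.+ suc s
        |L′|+s = trans (cong (ℕ._+ s) |L′|) (ℕP.+-assoc (length L) 1 s)
        unique′ : Unique (map proj₁ L′ ++ S)
        unique′ = subst Unique (sym (trans (cong (_++ S) (ListP.map-++ proj₁ L [ (u , c) ]))
                                           (ListP.++-assoc (map proj₁ L) [ u ] S))) unique
        L′+j≤d : length L′ ℕ.+ j ℕ.≤ d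
        L′+j≤d = ℕP.≤-trans (ℕP.≤-reflexive (trans (cong (ℕ._+ j) |L′|) (ℕP.+-assoc (length L) 1 j)))
                            (ℕP.≤-trans (ℕP.+-monoʳ-≤ (length L) j<n) L+n≤d)
        reassoc : ∀ a b c d → a * (b * c) * d ≡ a * b * (c * d)
        reassoc = solve-∀

      term : ∀ j → j ℕ.≤ n → ∑ᴸ H (λ h → T h j) * P ≡ ∣H∣ * νᴸ L * ℤ.+ (ν (n ∸ j) ℕ.* M j s)
      term j j≤n with ℕP.m≤n⇒m<n∨m≡n j≤n
      ... | inj₁ j<n  = inner-term j j<n
      ... | inj₂ refl = last-term

      moment-step : ∑ᴸ H (λ h → W h L * Y h (u ∷ S) ^ n) * P ≡ ∣H∣ * νᴸ L * ℤ.+ (M n (suc s))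
      moment-step = begin
          ∑ᴸ H (λ h → W h L * Y h (u ∷ S) ^ n) * P
        ≡⟨ cong (_* P) (∑ᴸ-cong H expand) ⟩
          ∑ᴸ H (λ h → sum {suc n} (λ j → ℤ.+ (n C toℕ j) * T h (toℕ j))) * P
        ≡⟨ trans (cong (_* P) (∑ᴸ-comm-sum H {suc n} (λ h j → ℤ.+ (n C toℕ j) * T h (toℕ j))))
                 (*-distribʳ-sum {suc n} P (λ j → ∑ᴸ H (λ h → ℤ.+ (n C toℕ j) * T h (toℕ j)))) ⟩
          sum {suc n} (λ j → ∑ᴸ H (λ h → ℤ.+ (n C toℕ j) * T h (toℕ j)) * P)
        ≡⟨ sum-cong-≗ {suc n} (λ j → trans (cong (_* P) (sym (*-distribˡ-∑ᴸ (ℤ.+ (n C toℕ j)) H (λ h → T h (toℕ j)))))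
                                           (ℤP.*-assoc (ℤ.+ (n C toℕ j)) _ P)) ⟩
          sum {suc n} (λ j → ℤ.+ (n C toℕ j) * (∑ᴸ H (λ h → T h (toℕ j)) * P))
        ≡⟨ sum-cong-≗ {suc n} (λ j → cong (ℤ.+ (n C toℕ j) *_) (term (toℕ j) (ℕ.s≤s⁻¹ (FinP.toℕ<n j)))) ⟩
          sum {suc n} (λ j → ℤ.+ (n C toℕ j) * (∣H∣ * νᴸ L * ℤ.+ (ν (n ∸ toℕ j) ℕ.* M (toℕ j) s)))
        ≡⟨ sum-cong-≗ {suc n} (λ j → rearrange (n C toℕ j) (ν (n ∸ toℕ j)) (M (toℕ j) s) (∣H∣ * νᴸ L)) ⟩
          sum {suc n} (λ j → ∣H∣ * νᴸ L * ℤ.+ ((n C toℕ j) ℕ.* ν (n ∸ toℕ j) ℕ.* M (toℕ j) s))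
        ≡⟨ *-distribˡ-sum {suc n} (∣H∣ * νᴸ L) (λ j → ℤ.+ ((n C toℕ j) ℕ.* ν (n ∸ toℕ j) ℕ.* M (toℕ j) s)) ⟨
          ∣H∣ * νᴸ L * sum {suc n} (λ j → ℤ.+ ((n C toℕ j) ℕ.* ν (n ∸ toℕ j) ℕ.* M (toℕ j) s))
        ≡⟨ cong (∣H∣ * νᴸ L *_) (+sumℕ (suc n) (λ j → (n C toℕ j) ℕ.* ν (n ∸ toℕ j) ℕ.* M (toℕ j) s)) ⟨
          ∣H∣ * νᴸ L * ℤ.+ (M n (suc s)) ∎
        where
        open ≡-Reasoning
        rearrange : ∀ a b m X → ℤ.+ a * (X * ℤ.+ (b ℕ.* m)) ≡ X * ℤ.+ (a ℕ.* b ℕ.* m)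
        rearrange a b m X =
          trans (cong (λ t → ℤ.+ a * (X * t)) (ℤP.pos-* b m))
          (trans (ring (ℤ.+ a) (ℤ.+ b) (ℤ.+ m) X)
                 (cong (X *_) (sym (trans (ℤP.pos-* (a ℕ.* b) m) (cong (_* ℤ.+ m) (ℤP.pos-* a b))))))
          where
          ring : ∀ a b m X → a * (X * (b * m)) ≡ X * (a * b * m)
          ring = solve-∀

    moment-identity : ∀ S → MomentIdentity S
    moment-identity []      = moment-[]
    moment-identity (u ∷ S) = moment-step u S (moment-identity S)

module MomentBound where

  open import Data.Unit using (tt)
  open import Data.Nat using (ℕ; zero; suc; _+_; _*_; _∸_; _^_; _≤_; _<_; z≤n; s≤s; ⌊_/2⌋; _≤?_)
  import Data.Nat.Properties as ℕP
  open import Data.Nat.Combinatorics using (_C_; nCn≡1)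
  open import Data.Fin as Fin using (Fin; toℕ; fromℕ; fromℕ<; inject₁)
  import Data.Fin.Properties as FinP
  open import Data.Sum using (inj₁; inj₂)
  open import Relation.Binary.PropositionalEquality
  open import Relation.Nullary.Decidable using (toWitness)
  open import Function using (_∘_)
  open import Algebra.Properties.Semiring.Sum ℕP.+-*-semiring using (sum; sum-init-last; *-distribʳ-sum)
  open import Data.Nat.Tactic.RingSolver using (solve-∀)
  open Nomination using (ν)
  open Moments using (M)

  A : ℕ
  A = 32

  sum-mono-≤ : ∀ {n} {f g : Fin n → ℕ} → (∀ i → f i ≤ g i) → sum f ≤ sum g
  sum-mono-≤ {zero}  f≤g = z≤n
  sum-mono-≤ {suc n} f≤g = ℕP.+-mono-≤ (f≤g _) (sum-mono-≤ (f≤g ∘ Fin.suc))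

  D : ℕ → ℕ
  D k = sum {k} (λ i → (k C toℕ i) * ν (k ∸ toℕ i) * A ^ toℕ i)

  D-bound : ∀ k → k ≤ 10 → D k ≤ 4 * A ^ k
  D-bound k k≤10 = subst (λ m → D m ≤ 4 * A ^ m) (FinP.toℕ-fromℕ< (s≤s k≤10))
    (toWitness {a? = FinP.all? (λ (m : Fin 11) → D (toℕ m) ≤? 4 * A ^ toℕ m)} tt (fromℕ< (s≤s k≤10)))

  D-vanishes : ∀ k → ⌊ k /2⌋ ≡ 0 → D k ≡ 0
  D-vanishes 0             _  = refl
  D-vanishes 1             _  = refl
  D-vanishes (suc (suc k)) ()

  -- Xʰ⁻¹ + Xʰ ≤ (X + 1)ʰ, with D absorbing the lower-order terms.
  M-bound-step : ∀ h D a f X → D ≤ 4 * a → (h ≡ 0 → D ≡ 0) →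
    D * (f * X ^ (h ∸ 1)) + 4 * (a * f * X ^ h) ≤ a * (4 * f) * suc X ^ h
  M-bound-step zero    D a f X _ D≡0 rewrite D≡0 refl = ℕP.≤-reflexive (ring a f)
    where
    ring : ∀ a f → 0 * (f * 1) + 4 * (a * f * 1) ≡ a * (4 * f) * 1
    ring = solve-∀
  M-bound-step (suc h) D a f X D≤4a _ = begin
      D * (f * X ^ h) + 4 * (a * f * X ^ suc h)
    ≤⟨ ℕP.+-monoˡ-≤ _ (ℕP.*-monoˡ-≤ (f * X ^ h) D≤4a) ⟩
      4 * a * (f * X ^ h) + 4 * (a * f * X ^ suc h)
    ≡⟨ ring a f X (X ^ h) ⟩
      a * (4 * f) * (suc X * X ^ h)
    ≤⟨ ℕP.*-monoʳ-≤ (a * (4 * f)) (ℕP.*-monoʳ-≤ (suc X) (ℕP.^-monoˡ-≤ h (ℕP.n≤1+n X))) ⟩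
      a * (4 * f) * suc X ^ suc h ∎
    where
    open ℕP.≤-Reasoning
    ring : ∀ a f X Y → 4 * a * (f * Y) + 4 * (a * f * (X * Y)) ≡ a * (4 * f) * ((1 + X) * Y)
    ring = solve-∀

  M-bound : ∀ s k → k ≤ 10 → M k s ≤ A ^ k * 4 ^ s * suc s ^ ⌊ k /2⌋
  M-bound zero    zero    _     = ℕP.≤-refl
  M-bound zero    (suc k) _     = z≤n
  M-bound (suc s) k       k≤10 = begin
      M k (suc s)
    ≡⟨ sum-init-last T ⟩
      sum (T ∘ inject₁) + T (fromℕ k)
    ≤⟨ ℕP.+-mono-≤ (ℕP.≤-trans (sum-mono-≤ lower) (ℕP.≤-reflexive (sym (*-distribʳ-sum {k} (4 ^ s * X ^ (⌊ k /2⌋ ∸ 1)) (λ i → (k C toℕ i) * ν (k ∸ toℕ i) * A ^ toℕ i)))))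
                   top ⟩
      D k * (4 ^ s * X ^ (⌊ k /2⌋ ∸ 1)) + 4 * (A ^ k * 4 ^ s * X ^ ⌊ k /2⌋)
    ≤⟨ M-bound-step ⌊ k /2⌋ (D k) (A ^ k) (4 ^ s) X (D-bound k k≤10) (D-vanishes k) ⟩
      A ^ k * 4 ^ suc s * suc X ^ ⌊ k /2⌋ ∎
    where
    open ℕP.≤-Reasoning
    X = suc s
    T : Fin (suc k) → ℕ
    T i = (k C toℕ i) * ν (k ∸ toℕ i) * M (toℕ i) s

    top : T (fromℕ k) ≤ 4 * (A ^ k * 4 ^ s * X ^ ⌊ k /2⌋)
    top = subst (_≤ 4 * (A ^ k * 4 ^ s * X ^ ⌊ k /2⌋)) (sym T[k]≡4M) (ℕP.*-monoʳ-≤ 4 (M-bound s k k≤10))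
      where
      T[k]≡4M : T (fromℕ k) ≡ 4 * M k s
      T[k]≡4M = trans (cong (λ m → (k C m) * ν (k ∸ m) * M m s) (FinP.toℕ-fromℕ k))
                      (cong₂ (λ c m → c * ν m * M k s) (nCn≡1 k) (ℕP.n∸n≡0 k))

    -- ν 1 = 0 kills j = k − 1; for j ≤ k − 2 the exponent ⌊ j /2⌋ drops by one.
    lower′ : ∀ j → j < k → (k C j) * ν (k ∸ j) * M j s ≤ (k C j) * ν (k ∸ j) * A ^ j * (4 ^ s * X ^ (⌊ k /2⌋ ∸ 1))
    lower′ j j<k with ℕP.m≤n⇒m<n∨m≡n j<k
    ... | inj₂ refl = subst (_≤ (suc j C j) * ν (suc j ∸ j) * A ^ j * (4 ^ s * X ^ (⌊ suc j /2⌋ ∸ 1))) (sym T[j]≡0) z≤n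
      where
      T[j]≡0 : (suc j C j) * ν (suc j ∸ j) * M j s ≡ 0
      T[j]≡0 = trans (cong (λ t → (suc j C j) * ν t * M j s) (ℕP.m+n∸n≡m 1 j))
                     (cong (_* M j s) (ℕP.*-zeroʳ (suc j C j)))
    ... | inj₁ j+1<k = begin
        (k C j) * ν (k ∸ j) * M j s
      ≤⟨ ℕP.*-monoʳ-≤ ((k C j) * ν (k ∸ j)) (M-bound s j (ℕP.≤-trans (ℕP.<⇒≤ j<k) k≤10)) ⟩
        (k C j) * ν (k ∸ j) * (A ^ j * 4 ^ s * X ^ ⌊ j /2⌋)
      ≤⟨ ℕP.*-monoʳ-≤ ((k C j) * ν (k ∸ j)) (ℕP.*-monoʳ-≤ (A ^ j * 4 ^ s) (ℕP.^-monoʳ-≤ X ⌊j/2⌋<⌊k/2⌋)) ⟩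
        (k C j) * ν (k ∸ j) * (A ^ j * 4 ^ s * X ^ (⌊ k /2⌋ ∸ 1))
      ≡⟨ ring ((k C j) * ν (k ∸ j)) (A ^ j) (4 ^ s) (X ^ (⌊ k /2⌋ ∸ 1)) ⟩
        (k C j) * ν (k ∸ j) * A ^ j * (4 ^ s * X ^ (⌊ k /2⌋ ∸ 1)) ∎
      where
      ⌊j/2⌋<⌊k/2⌋ : ⌊ j /2⌋ ≤ ⌊ k /2⌋ ∸ 1
      ⌊j/2⌋<⌊k/2⌋ = subst (_≤ ⌊ k /2⌋ ∸ 1) (ℕP.m+n∸n≡m ⌊ j /2⌋ 1)
        (ℕP.∸-monoˡ-≤ 1 (subst (_≤ ⌊ k /2⌋) (ℕP.+-comm 1 ⌊ j /2⌋) (ℕP.⌊n/2⌋-mono j+1<k)))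
      ring : ∀ c a f x → c * (a * f * x) ≡ c * a * (f * x)
      ring = solve-∀

    lower : ∀ i → T (inject₁ i) ≤ (k C toℕ i) * ν (k ∸ toℕ i) * A ^ toℕ i * (4 ^ s * X ^ (⌊ k /2⌋ ∸ 1))
    lower i rewrite FinP.toℕ-inject₁ i = lower′ (toℕ i) (FinP.toℕ<n i)

module Counting where

  open import Data.Bool using (Bool; true; false; _∧_; not; if_then_else_)
  open import Data.Bool.Properties using (T?)
  open import Data.Nat as ℕ using (ℕ; suc; _∸_; z≤n; s≤s)
  import Data.Nat.Properties as ℕP
  open import Data.Nat.ListAction using (sum)
  open import Data.Integer as ℤ using (0ℤ; 1ℤ; -[1+_]; _+_; _*_; _-_; ∣_∣)
  import Data.Integer.Properties as ℤP
  open import Data.Fin using (Fin)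
  open import Data.List using (List; []; _∷_; map; allFin; filter)
  open import Data.Sum using (inj₁; inj₂)
  open import Relation.Binary.PropositionalEquality
  open import Function using (_∘_)
  open import Data.Integer.Tactic.RingSolver using (solve-∀)
  open Sums
  open Nomination
  open Moments using (Y)

  module _ {A : Set} where

    countList≡sum : (P : A → Bool) (xs : List A) → countList P xs ≡ sum (map (λ x → if P x then 1 else 0) xs)
    countList≡sum P []       = refl
    countList≡sum P (x ∷ xs) with P x
    ... | true  = cong suc (countList≡sum P xs)
    ... | false = countList≡sum P xs

    countList-mono : (P Q : A → Bool) → (∀ x → P x ≡ true → Q x ≡ true) → ∀ xs → countList P xs ℕ.≤ countList Q xs
    countList-mono P Q P⇒Q []       = z≤n
    countList-mono P Q P⇒Q (x ∷ xs) with P x in Px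
    ... | true rewrite P⇒Q x Px = s≤s (countList-mono P Q P⇒Q xs)
    ... | false with Q x
    ...   | true  = ℕP.m≤n⇒m≤1+n (countList-mono P Q P⇒Q xs)
    ...   | false = countList-mono P Q P⇒Q xs

    countList-∧ : (P Q : A → Bool) → ∀ xs →
      countList (λ x → not (P x ∧ Q x)) xs ℕ.≤ countList (not ∘ P) xs ℕ.+ countList (not ∘ Q) xs
    countList-∧ P Q []       = z≤n
    countList-∧ P Q (x ∷ xs) with P x | Q x
    ... | true  | true  = countList-∧ P Q xs
    ... | true  | false = ℕP.≤-trans (s≤s (countList-∧ P Q xs)) (ℕP.≤-reflexive (sym (ℕP.+-suc _ _)))
    ... | false | true  = s≤s (countList-∧ P Q xs)
    ... | false | false = s≤s (ℕP.≤-trans (countList-∧ P Q xs) (ℕP.+-monoʳ-≤ _ (ℕP.n≤1+n _)))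

    markov : (P : A → Bool) (K : ℕ) (g : A → ℕ) → (∀ x → P x ≡ true → K ℕ.≤ g x) →
      ∀ xs → countList P xs ℕ.* K ℕ.≤ sum (map g xs)
    markov P K g P⇒K≤g []       = z≤n
    markov P K g P⇒K≤g (x ∷ xs) with P x in Px
    ... | true  = ℕP.+-mono-≤ (P⇒K≤g x Px) (markov P K g P⇒K≤g xs)
    ... | false = ℕP.≤-trans (markov P K g P⇒K≤g xs) (ℕP.m≤n+m _ (g x))

    +sum-map : (g : A → ℕ) (xs : List A) → ℤ.+ sum (map g xs) ≡ ∑ᴸ xs (λ x → ℤ.+ g x)
    +sum-map g []       = refl
    +sum-map g (x ∷ xs) = trans (ℤP.pos-+ (g x) _) (cong (ℤ.+ g x +_) (+sum-map g xs))

    -- Each selected element contributes 4·[Q] − 1 = ζ Q.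
    4∑𝟙-∑𝟙≡∑ζ : (P Q : A → Bool) (xs : List A) →
      ℤ.+ 4 * ∑ᴸ xs (λ x → 𝟙 (P x ∧ Q x)) - ∑ᴸ xs (𝟙 ∘ P) ≡ ∑ᴸ (filter (λ x → T? (P x)) xs) (ζ ∘ Q)
    4∑𝟙-∑𝟙≡∑ζ P Q []       = refl
    4∑𝟙-∑𝟙≡∑ζ P Q (x ∷ xs) with P x
    ... | true  = trans (step (Q x) (∑ᴸ xs (λ x → 𝟙 (P x ∧ Q x))) (∑ᴸ xs (𝟙 ∘ P))) (cong (ζ (Q x) +_) (4∑𝟙-∑𝟙≡∑ζ P Q xs))
      where
      step : ∀ q a b → ℤ.+ 4 * (𝟙 q + a) - (1ℤ + b) ≡ ζ q + (ℤ.+ 4 * a - b)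
      step true  = solve-∀
      step false = solve-∀
    ... | false = trans (skip (∑ᴸ xs (λ x → 𝟙 (P x ∧ Q x))) (∑ᴸ xs (𝟙 ∘ P))) (4∑𝟙-∑𝟙≡∑ζ P Q xs)
      where
      skip : ∀ a b → ℤ.+ 4 * (0ℤ + a) - (0ℤ + b) ≡ ℤ.+ 4 * a - b
      skip = solve-∀

  ∸≤∣-∣ : ∀ a b → a ∸ b ℕ.≤ ∣ ℤ.+ a - ℤ.+ b ∣
  ∸≤∣-∣ a b with ℕP.≤-total b a
  ... | inj₁ b≤a = ℕP.≤-reflexive (sym (cong ∣_∣ (trans (ℤP.m-n≡m⊖n a b) (ℤP.⊖-≥ b≤a))))
  ... | inj₂ a≤b = subst (ℕ._≤ ∣ ℤ.+ a - ℤ.+ b ∣) (sym (ℕP.m≤n⇒m∸n≡0 a≤b)) z≤n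

  +∣i∣^10≡i^10 : ∀ i → ℤ.+ (∣ i ∣ ℕ.^ 10) ≡ i ℤ.^ 10
  +∣i∣^10≡i^10 i = begin
      ℤ.+ (∣ i ∣ ℕ.^ 10)               ≡⟨ cong ℤ.+_ (square-power ∣ i ∣) ⟩
      ℤ.+ ((∣ i ∣ ℕ.* ∣ i ∣) ℕ.^ 5)     ≡⟨ +^≡+^ (∣ i ∣ ℕ.* ∣ i ∣) 5 ⟨
      (ℤ.+ (∣ i ∣ ℕ.* ∣ i ∣)) ℤ.^ 5     ≡⟨ cong (ℤ._^ 5) (i*i≡+∣i∣² i) ⟨
      (i * i) ℤ.^ 5                    ≡⟨ square-power-ℤ i ⟩
      i ℤ.^ 10                         ∎
    where
    open ≡-Reasoning
    square-power : ∀ a → a ℕ.^ 10 ≡ (a ℕ.* a) ℕ.^ 5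
    square-power a = trans (sym (ℕP.^-*-assoc a 2 5)) (cong (λ t → (a ℕ.* t) ℕ.^ 5) (ℕP.*-identityʳ a))
    square-power-ℤ : ∀ x → (x * x) ℤ.^ 5 ≡ x ℤ.^ 10
    square-power-ℤ x = trans (cong (λ t → (x * t) ℤ.^ 5) (sym (ℤP.*-identityʳ x))) (ℤP.^-*-assoc x 2 5)
    i*i≡+∣i∣² : ∀ i → i * i ≡ ℤ.+ (∣ i ∣ ℕ.* ∣ i ∣)
    i*i≡+∣i∣² (ℤ.+ n)  = sym (ℤP.pos-* n n)
    i*i≡+∣i∣² -[1+ n ] = refl

  module _ {N R : ℕ} (G : Graph N) (h : Fin N → Fin R) where

    4·nominated-count : (P : Fin N → Bool) →
      ℤ.+ (4 ℕ.* countFin (λ u → P u ∧ nominates h u)) - ℤ.+ countFin P ≡ Y h (filter (λ u → T? (P u)) (allFin N))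
    4·nominated-count P = trans (cong₂ (λ a b → a - b)
        (trans (ℤP.pos-* 4 (countFin (λ u → P u ∧ nominates h u))) (cong (ℤ.+ 4 *_) (+countFin (λ u → P u ∧ nominates h u))))
        (+countFin P))
      (4∑𝟙-∑𝟙≡∑ζ P (nominates h) (allFin N))
      where
      +countFin : (Q : Fin N → Bool) → ℤ.+ countFin Q ≡ ∑ᴸ (allFin N) (𝟙 ∘ Q)
      +countFin Q = trans (cong ℤ.+_ (sym (countList≡sum Q (allFin N)))) (+count≡∑ᴸ𝟙 Q (allFin N))

open import Data.Bool using (true; false; not; T)
open import Data.Bool.Properties using (T?)
open import Data.Unit using (tt)
open import Data.Empty using (⊥-elim)
open import Data.Nat using (ℕ; zero; suc; _+_; _*_; _∸_; _^_; _≤_; _<_; _≤ᵇ_; z≤n; s≤s; NonZero; >-nonZero)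
import Data.Nat.Properties as ℕP
open import Data.Nat.ListAction using (sum)
open import Data.Nat.Divisibility using (_∣_; divides)
open import Data.Integer as ℤ using (∣_∣)
import Data.Integer.Properties as ℤP
open import Data.Fin using (Fin)
open import Data.Fin.Properties using (¬Fin0)
open import Data.List using (List; []; _∷_; map; allFin; length; filter)
open import Data.List.Relation.Unary.Unique.Propositional using (Unique)
import Data.List.Relation.Unary.Unique.Propositional.Properties as Unique
open import Data.Product using (∃-syntax; _,_)
open import Relation.Binary.PropositionalEquality
open import Data.Nat.Tactic.RingSolver using (solve-∀)
open Sums
open Moments
open MomentBound
open Counting

not-≤ᵇ⇒> : ∀ a b → not (a ≤ᵇ b) ≡ true → b < a
not-≤ᵇ⇒> a b a≰ᵇb with a ≤ᵇ b in a≤ᵇb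
... | false = ℕP.≰⇒> (λ a≤b → subst T a≤ᵇb (ℕP.≤⇒≤ᵇ a≤b))

fails-threshold : ∀ x p → not (le4p07 x p) ≡ true → 4 ^ 10 * p ^ 7 ≤ x ^ 10
fails-threshold x p fails = ℕP.<⇒≤ (not-≤ᵇ⇒> (x ^ 10) (4 ^ 10 * p ^ 7) fails)

module _ {N d r : ℕ} .{{_ : NonZero r}} (H : List (Fin N → Fin (r * 4)))
         (independent : KWiseIndependent d H) (10≤d : 10 ≤ d) where

  tenth-moment : (S : List (Fin N)) → Unique S → sum (map (λ h → ∣ Y h S ∣ ^ 10) H) * 4 ^ length S ≡ length H * M 10 (length S)
  tenth-moment S unique = ℤP.+-injective (begin
      ℤ.+ (sum (map (λ h → ∣ Y h S ∣ ^ 10) H) * 4 ^ s)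
    ≡⟨ ℤP.pos-* (sum (map (λ h → ∣ Y h S ∣ ^ 10) H)) (4 ^ s) ⟩
      ℤ.+ sum (map (λ h → ∣ Y h S ∣ ^ 10) H) ℤ.* ℤ.+ (4 ^ s)
    ≡⟨ cong (ℤ._* ℤ.+ (4 ^ s)) (trans (+sum-map (λ h → ∣ Y h S ∣ ^ 10) H) (∑ᴸ-cong H (λ h → trans (+∣i∣^10≡i^10 (Y h S)) (sym (ℤP.*-identityˡ _))))) ⟩
      ∑ᴸ H (λ h → W h [] ℤ.* Y h S ℤ.^ 10) ℤ.* ℤ.+ (4 ^ (0 + s))
    ≡⟨ moment-identity H independent S [] 10 unique 10≤d ⟩
      ℤ.+ length H ℤ.* ℤ.+ 1 ℤ.* ℤ.+ M 10 s
    ≡⟨ cong (ℤ._* ℤ.+ M 10 s) (ℤP.*-identityʳ (ℤ.+ length H)) ⟩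
      ℤ.+ length H ℤ.* ℤ.+ M 10 s
    ≡⟨ ℤP.pos-* (length H) (M 10 s) ⟨
      ℤ.+ (length H * M 10 s) ∎)
    where
    open ≡-Reasoning
    s = length S

  tail-bound : (S : List (Fin N)) → Unique S → (X : (Fin N → Fin (r * 4)) → ℕ) → (∀ h → X h ≤ ∣ Y h S ∣) →
    (p : ℕ) → length S < p →
    countList (λ h → not (le4p07 (X h) p)) H * (4 ^ 10 * p ^ 7) ≤ length H * A ^ 10 * p ^ 5
  tail-bound S unique X X≤∣Y∣ p |S|<p = begin
      countList (λ h → not (le4p07 (X h) p)) H * (4 ^ 10 * p ^ 7)
    ≤⟨ markov _ _ (λ h → ∣ Y h S ∣ ^ 10)
              (λ h fails → ℕP.≤-trans (fails-threshold (X h) p fails) (ℕP.^-monoˡ-≤ 10 (X≤∣Y∣ h))) H ⟩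
      sum (map (λ h → ∣ Y h S ∣ ^ 10) H)
    ≤⟨ ℕP.*-cancelʳ-≤ _ _ (4 ^ s) {{ℕP.m^n≢0 4 s}} moment-bound ⟩
      length H * A ^ 10 * suc s ^ 5
    ≤⟨ ℕP.*-monoʳ-≤ (length H * A ^ 10) (ℕP.^-monoˡ-≤ 5 |S|<p) ⟩
      length H * A ^ 10 * p ^ 5 ∎
    where
    open ℕP.≤-Reasoning
    s = length S
    moment-bound : sum (map (λ h → ∣ Y h S ∣ ^ 10) H) * 4 ^ s ≤ length H * A ^ 10 * suc s ^ 5 * 4 ^ s
    moment-bound = begin
        sum (map (λ h → ∣ Y h S ∣ ^ 10) H) * 4 ^ s
      ≡⟨ tenth-moment S unique ⟩
        length H * M 10 s
      ≤⟨ ℕP.*-monoʳ-≤ (length H) (M-bound s 10 ℕP.≤-refl) ⟩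
        length H * (A ^ 10 * 4 ^ s * suc s ^ 5)
      ≡⟨ reorder (length H) (A ^ 10) (4 ^ s) (suc s ^ 5) ⟩
        length H * A ^ 10 * suc s ^ 5 * 4 ^ s ∎
      where
      reorder : ∀ h a f x → h * (a * f * x) ≡ h * a * x * f
      reorder = solve-∀

-- Chosen so that 2·A¹⁰ = 4¹⁰·C₀ (= 2⁵¹).
C₀ : ℕ
C₀ = 2 * 4 ^ 15

failure-rate : ∀ c h p K a C .{{_ : NonZero a}} .{{_ : NonZero p}} → 2 * a ≡ K * C → C ≤ p →
  c * (K * p ^ 7) ≤ h * a * p ^ 5 → 2 * c * p ≤ h
failure-rate c h p K a C 2a≡KC C≤p tail = ℕP.*-cancelʳ-≤ (2 * c * p) h a (begin
    2 * c * p * a      ≡⟨ ring₁ c p a ⟩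
    c * p * (2 * a)    ≡⟨ cong (c * p *_) 2a≡KC ⟩
    c * p * (K * C)    ≤⟨ ℕP.*-monoʳ-≤ (c * p) (ℕP.*-monoʳ-≤ K C≤p) ⟩
    c * p * (K * p)    ≡⟨ ring₂ c p K ⟩
    c * K * p * p      ≤⟨ ℕP.*-cancelʳ-≤ _ _ (p ^ 5) {{ℕP.m^n≢0 p 5}} (subst (_≤ h * a * p ^ 5) (ring₃ c K p (p ^ 5)) tail) ⟩
    h * a              ∎)
  where
  open ℕP.≤-Reasoning
  ring₁ : ∀ c p a → 2 * c * p * a ≡ c * p * (2 * a)
  ring₁ = solve-∀
  ring₂ : ∀ c p k → c * p * (k * p) ≡ c * k * p * p
  ring₂ = solve-∀
  ring₃ : ∀ c k p q → c * (k * (p * (p * q))) ≡ c * k * p * p * q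
  ring₃ = solve-∀

union-bound : ∀ f c₁ c₂ p h → f ≤ c₁ + c₂ → 2 * c₁ * p ≤ h → 2 * c₂ * p ≤ h → f * p ≤ h
union-bound f c₁ c₂ p h f≤c₁+c₂ 2c₁p≤h 2c₂p≤h = ℕP.*-cancelˡ-≤ 2 (begin
    2 * (f * p)                ≤⟨ ℕP.*-monoʳ-≤ 2 (ℕP.*-monoˡ-≤ p f≤c₁+c₂) ⟩
    2 * ((c₁ + c₂) * p)        ≡⟨ distrib c₁ c₂ p ⟩
    2 * c₁ * p + 2 * c₂ * p    ≤⟨ ℕP.+-mono-≤ 2c₁p≤h 2c₂p≤h ⟩
    h + h                      ≡⟨ double h ⟩
    2 * h                      ∎)
  where
  open ℕP.≤-Reasoning
  distrib : ∀ a b p → 2 * ((a + b) * p) ≡ 2 * a * p + 2 * b * p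
  distrib = solve-∀
  double : ∀ h → h + h ≡ 2 * h
  double = solve-∀

module _ {N : ℕ} (G : Graph N) (v : Fin N) where

  neighbours heavy-neighbours : List (Fin N)
  neighbours       = filter (λ u → T? (adj G v u)) (allFin N)
  heavy-neighbours = filter (λ u → T? (inNStar G v u)) (allFin N)

  excess≤∣Y∣ : ∀ {R} (h : Fin N → Fin R) → 4 * nomCount G h v ∸ deg G v ≤ ∣ Y h neighbours ∣
  excess≤∣Y∣ h = ℕP.≤-trans (∸≤∣-∣ (4 * nomCount G h v) (deg G v))
    (ℕP.≤-reflexive (cong ∣_∣ (4·nominated-count G h (adj G v))))

  deficit≤∣Y∣ : ∀ {R} (h : Fin N → Fin R) → nStarCount G v ∸ 4 * nomStarCount G h v ≤ ∣ Y h heavy-neighbours ∣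
  deficit≤∣Y∣ h = ℕP.≤-trans (∸≤∣-∣ (nStarCount G v) (4 * nomStarCount G h v))
    (ℕP.≤-reflexive (trans (ℤP.∣i-j∣≡∣j-i∣ (ℤ.+ nStarCount G v) (ℤ.+ (4 * nomStarCount G h v))) (cong ∣_∣ (4·nominated-count G h (inNStar G v)))))

  |neighbours| : length neighbours ≡ deg G v
  |neighbours| = countList≡sum (adj G v) (allFin N)

  |heavy-neighbours|≤deg : length heavy-neighbours ≤ deg G v
  |heavy-neighbours|≤deg = ℕP.≤-trans (countList-mono (inNStar G v) (adj G v) heavy⇒adjacent (allFin N))
                                      (ℕP.≤-reflexive |neighbours|)
    where
    heavy⇒adjacent : ∀ u → inNStar G v u ≡ true → adj G v u ≡ true
    heavy⇒adjacent u e with adj G v u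
    ... | true = refl

  failure-count : (p : Fin N → ℕ) → suc (deg G v) ≤ p v → C₀ ≤ p v →
    ∀ {r} .{{_ : NonZero r}} (H : List (Fin N → Fin (r * 4))) → KWiseIndependent 101 H →
    countList (λ h → fails G p h v) H * p v ≤ length H
  failure-count p deg<p C₀≤p {r} H independent =
    union-bound (countList (λ h → fails G p h v) H) c₁ c₂ (p v) (length H)
      (countList-∧ (λ h → le4p07 (excess h) (p v)) (λ h → le4p07 (deficit h) (p v)) H)
      (rate c₁ (tail-bound H independent 10≤101 neighbours (Unique.filter⁺ _ (Unique.allFin⁺ N)) excess excess≤∣Y∣ (p v)
                        (subst (_< p v) (sym |neighbours|) deg<p)))
      (rate c₂ (tail-bound H independent 10≤101 heavy-neighbours (Unique.filter⁺ _ (Unique.allFin⁺ N)) deficit deficit≤∣Y∣ (p v)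
                        (ℕP.<-≤-trans (s≤s |heavy-neighbours|≤deg) deg<p)))
    where
    10≤101 : 10 ≤ 101
    10≤101 = ℕP.≤ᵇ⇒≤ 10 101 tt
    instance
      p≢0 : NonZero (p v)
      p≢0 = >-nonZero (ℕP.<-≤-trans (s≤s z≤n) deg<p)
    excess deficit : (Fin N → Fin (r * 4)) → ℕ
    excess  h = 4 * nomCount G h v ∸ deg G v
    deficit h = nStarCount G v ∸ 4 * nomStarCount G h v
    c₁ c₂ : ℕ
    c₁ = countList (λ h → not (le4p07 (excess h) (p v))) H
    c₂ = countList (λ h → not (le4p07 (deficit h) (p v))) H
    rate : ∀ c → c * (4 ^ 10 * p v ^ 7) ≤ length H * A ^ 10 * p v ^ 5 → 2 * c * p v ≤ length H
    rate c = failure-rate c (length H) (p v) (4 ^ 10) (A ^ 10) C₀ {{ℕP.m^n≢0 A 10}} refl C₀≤p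

mainTheorem2 : ∃[ C ] (∀ (N : ℕ) (G : Graph N) (p : Fin N → ℕ) →
    (∀ v → suc (deg G v) ≤ p v) → (∀ v → C ≤ p v) →
    ∀ (R : ℕ) → 4 ∣ R → (H : List (Fin N → Fin R)) → KWiseIndependent 101 H →
    ∀ (v : Fin N) → countList (λ h → fails G p h v) H * p v ≤ length H)
mainTheorem2 = C₀ , λ N G p deg<p C₀≤p R 4∣R H independent v → bound G p (deg<p v) (C₀≤p v) 4∣R H independent
  where
  bound : ∀ {N R} (G : Graph N) (p : Fin N → ℕ) {v} → suc (deg G v) ≤ p v → C₀ ≤ p v → 4 ∣ R →
    (H : List (Fin N → Fin R)) → KWiseIndependent 101 H → countList (λ h → fails G p h v) H * p v ≤ length H
  bound G p {v} deg<p C₀≤p (divides (suc r) refl) H independent = failure-count G v p deg<p C₀≤p {suc r} H independent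
  bound G p deg<p C₀≤p (divides zero    refl) []      _ = z≤n
  bound G p {v} deg<p C₀≤p (divides zero refl) (h ∷ H) _ = ⊥-elim (¬Fin0 (h v))
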